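{- In an AL-monoid $A$, for all $a,b,c\in A$, if $a\leq b\leq c$ then $(a,b,c)M$, i.e. $a\ast b+b\ast c=a\ast c$.
   Context: An AL-monoid (autometrized lattice ordered monoid) is an algebra $(A,+,\vee,\wedge,\ast,0)$ of type $(2,2,2,2,0)$ such that: (1) $(A,+,\vee,\wedge,0)$ is a commutative lattice ordered monoid, i.e. $(A,+,0)$ is a commutative monoid with identity $0$, $(A,\vee,\wedge)$ is a lattice with induced order $\leq$, and $a+(b\vee c)=(a+b)\vee(a+c)$, $a+(b\wedge c)=(a+b)\wedge(a+c)$; (2) $a\ast(a\wedge b)+b=a\vee b$ for all $a,b$; (3) for each $a\in A$ the maps $x\mapsto a+x$, $x\mapsto a\vee x$, $x\mapsto a\wedge x$, $x\mapsto a\ast x$ are contractions with respect to $\ast$, i.e. $f(x)\ast f(y)\leq x\ast y$ for all $x,y$; (4) $[a\ast(a\vee b)]\wedge[b\ast(a\vee b)]=0$ for all $a,b$; and $\ast$ is a metric operation: $a\ast b\geq 0$ with equality iff $a=b$, $a\ast b=b\ast a$, and $a\ast b\leq a\ast c+c\ast b$ for all $a,b,c$. Metric betweenness: $(x,y,z)M$ means $x\ast y+y\ast z=x\ast z$. -}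

module Defs where

open import Level using (Level; suc; _⊔_)
open import Data.Product using (_×_)
open import Relation.Binary.PropositionalEquality using (_≡_)
open import Relation.Nullary using (¬_)

record ALMonoid (ℓ : Level) : Set (suc ℓ) where
  infixl 6 _+_
  infixr 7 _∨_
  infixr 8 _∧_
  infix 9 _∗_
  infix 4 _≤_
  field
    Carrier : Set ℓ
    _+_ _∨_ _∧_ _∗_ : Carrier → Carrier → Carrier
    𝟘 : Carrier

    +-assoc    : ∀ a b c → (a + b) + c ≡ a + (b + c)
    +-comm     : ∀ a b → a + b ≡ b + a
    +-identityˡ : ∀ a → 𝟘 + a ≡ a

    ∨-comm   : ∀ a b → a ∨ b ≡ b ∨ a
    ∨-assoc  : ∀ a b c → (a ∨ b) ∨ c ≡ a ∨ (b ∨ c)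
    ∧-comm   : ∀ a b → a ∧ b ≡ b ∧ a
    ∧-assoc  : ∀ a b c → (a ∧ b) ∧ c ≡ a ∧ (b ∧ c)
    ∨-absorbs-∧ : ∀ a b → a ∨ (a ∧ b) ≡ a
    ∧-absorbs-∨ : ∀ a b → a ∧ (a ∨ b) ≡ a

  _≤_ : Carrier → Carrier → Set ℓ
  a ≤ b = a ∧ b ≡ a

  field
    +-distrib-∨ : ∀ a b c → a + (b ∨ c) ≡ (a + b) ∨ (a + c)
    +-distrib-∧ : ∀ a b c → a + (b ∧ c) ≡ (a + b) ∧ (a + c)

    ∗-nonneg : ∀ a b → 𝟘 ≤ a ∗ b
    ∗-zero⇒≡ : ∀ a b → a ∗ b ≡ 𝟘 → a ≡ b
    ∗-self   : ∀ a → a ∗ a ≡ 𝟘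
    ∗-comm   : ∀ a b → a ∗ b ≡ b ∗ a
    ∗-triangle : ∀ a b c → a ∗ b ≤ (a ∗ c) + (c ∗ b)

    ax2 : ∀ a b → (a ∗ (a ∧ b)) + b ≡ a ∨ b
    contr-+ : ∀ a x y → (a + x) ∗ (a + y) ≤ x ∗ y
    contr-∨ : ∀ a x y → (a ∨ x) ∗ (a ∨ y) ≤ x ∗ y
    contr-∧ : ∀ a x y → (a ∧ x) ∗ (a ∧ y) ≤ x ∗ y
    contr-∗ : ∀ a x y → (a ∗ x) ∗ (a ∗ y) ≤ x ∗ y
    ax4 : ∀ a b → (a ∗ (a ∨ b)) ∧ (b ∗ (a ∨ b)) ≡ 𝟘

  M : Carrier → Carrier → Carrier → Set ℓ
  M x y z = (x ∗ y) + (y ∗ z) ≡ x ∗ z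

-- If a ≤ x then x = (x ∗ a) + a, so the distance from a is a "difference"
-- operation above a.  Writing b and c this way, translation by a is a
-- contraction, which bounds c ∗ b by (c ∗ a) ∗ (b ∗ a); adding b ∗ a, and using
-- that b ∗ a ≤ c ∗ a (meet with b is a contraction), gives
-- c ∗ b + b ∗ a ≤ c ∗ a.  The triangle inequality supplies the converse.
module Submission where

open import Defs
open import Level using (Level)
open import Relation.Binary.PropositionalEquality

module ALMonoidProperties {ℓ : Level} (A : ALMonoid ℓ) where
  open ALMonoid A

  ≤-trans : ∀ {x y z} → x ≤ y → y ≤ z → x ≤ z
  ≤-trans {x} {y} {z} x≤y y≤z = begin
    x ∧ z        ≡⟨ cong (_∧ z) (sym x≤y) ⟩
    (x ∧ y) ∧ z  ≡⟨ ∧-assoc x y z ⟩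
    x ∧ (y ∧ z)  ≡⟨ cong (x ∧_) y≤z ⟩
    x ∧ y        ≡⟨ x≤y ⟩
    x            ∎
    where open ≡-Reasoning

  ≤-antisym : ∀ {x y} → x ≤ y → y ≤ x → x ≡ y
  ≤-antisym {x} {y} x≤y y≤x = trans (sym x≤y) (trans (∧-comm x y) y≤x)

  ≤-resp-≡ : ∀ {x y x′ y′} → x ≡ x′ → y ≡ y′ → x ≤ y → x′ ≤ y′
  ≤-resp-≡ refl refl x≤y = x≤y

  +-monoˡ-≤ : ∀ z {x y} → x ≤ y → x + z ≤ y + z
  +-monoˡ-≤ z {x} {y} x≤y = begin
    (x + z) ∧ (y + z)  ≡⟨ cong₂ _∧_ (+-comm x z) (+-comm y z) ⟩
    (z + x) ∧ (z + y)  ≡⟨ sym (+-distrib-∧ z x y) ⟩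
    z + (x ∧ y)        ≡⟨ cong (z +_) x≤y ⟩
    z + x              ≡⟨ +-comm z x ⟩
    x + z              ∎
    where open ≡-Reasoning

  x≤y⇒y∧x≡x : ∀ {x y} → x ≤ y → y ∧ x ≡ x
  x≤y⇒y∧x≡x {x} {y} x≤y = trans (∧-comm y x) x≤y

  x≤y⇒y∗x+x≡y : ∀ {x y} → x ≤ y → y ∗ x + x ≡ y
  x≤y⇒y∗x+x≡y {x} {y} x≤y = begin
    y ∗ x + x        ≡⟨ cong (λ t → y ∗ t + x) (sym y∧x≡x) ⟩
    y ∗ (y ∧ x) + x  ≡⟨ ax2 y x ⟩
    y ∨ x            ≡⟨ cong (y ∨_) (sym y∧x≡x) ⟩
    y ∨ (y ∧ x)      ≡⟨ ∨-absorbs-∧ y x ⟩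
    y                ∎
    where
    open ≡-Reasoning
    y∧x≡x : y ∧ x ≡ x
    y∧x≡x = x≤y⇒y∧x≡x x≤y

  x≤y⇒x+y∗x≡y : ∀ {x y} → x ≤ y → x + y ∗ x ≡ y
  x≤y⇒x+y∗x≡y {x} {y} x≤y = trans (+-comm x (y ∗ x)) (x≤y⇒y∗x+x≡y x≤y)

  x≤y≤z⇒y∗x≤z∗x : ∀ {x y z} → x ≤ y → y ≤ z → y ∗ x ≤ z ∗ x
  x≤y≤z⇒y∗x≤z∗x {x} {y} {z} x≤y y≤z =
    ≤-resp-≡ (trans (cong₂ _∗_ (x≤y⇒y∧x≡x x≤y) y≤z) (∗-comm x y)) (∗-comm x z)
      (contr-∧ y x z)

  x≤y≤z⇒z∗y+y∗x≤z∗x : ∀ {x y z} → x ≤ y → y ≤ z → z ∗ y + y ∗ x ≤ z ∗ x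
  x≤y≤z⇒z∗y+y∗x≤z∗x {x} {y} {z} x≤y y≤z =
    ≤-resp-≡ refl (x≤y⇒y∗x+x≡y (x≤y≤z⇒y∗x≤z∗x x≤y y≤z))
      (+-monoˡ-≤ (y ∗ x) z∗y≤[z∗x]∗[y∗x])
    where
    z∗y≤[z∗x]∗[y∗x] : z ∗ y ≤ (z ∗ x) ∗ (y ∗ x)
    z∗y≤[z∗x]∗[y∗x] =
      ≤-resp-≡ (cong₂ _∗_ (x≤y⇒x+y∗x≡y (≤-trans x≤y y≤z)) (x≤y⇒x+y∗x≡y x≤y))
        refl (contr-+ x (z ∗ x) (y ∗ x))

mainTheorem10 : ∀ {ℓ : Level} (A : ALMonoid ℓ) → let open ALMonoid A in
                ∀ (a b c : Carrier) → a ≤ b → b ≤ c → M a b c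
mainTheorem10 A a b c a≤b b≤c = begin
  a ∗ b + b ∗ c  ≡⟨ +-comm (a ∗ b) (b ∗ c) ⟩
  b ∗ c + a ∗ b  ≡⟨ cong₂ _+_ (∗-comm b c) (∗-comm a b) ⟩
  c ∗ b + b ∗ a  ≡⟨ ≤-antisym (x≤y≤z⇒z∗y+y∗x≤z∗x a≤b b≤c) (∗-triangle c a b) ⟩
  c ∗ a          ≡⟨ ∗-comm c a ⟩
  a ∗ c          ∎
  where
  open ALMonoid A
  open ALMonoidProperties A
  open ≡-Reasoning
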